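{- Let $P\in Q_{\mathrm{paths}}$ and $q\in\{\mathrm{I},\mathrm{II},\mathrm{III},\mathrm{IV}\}$. Let $J_{\mathrm{opt}}$ be a maximum-size interval-disjoint subset of $\mathrm{Sq}(P_q)$ and let $J$ be an interval-disjoint subset of $\mathrm{Sq}(P_q)$ with $c|J|\ge|J_{\mathrm{opt}}|$ for some $c\ge 1$. Then $|\mathrm{Half}(J)|\ge \frac{1}{2c}\mathrm{OPT}(\mathrm{Sq}(P_q))-1$.
   Context: $Q^\infty$ is an infinite quadtree (each node an axis-aligned square split into four equal quadrant squares which are its children). $S$ is a finite set of axis-aligned squares; $\eta(s)$ is the smallest node whose square contains $s$; $s$ is centered if it contains the center of the square of $\eta(s)$; $\boxdot(S)$ is the set of centered squares; $\mathrm{Sq}(\eta)=\{s\in\boxdot(S):\eta(s)=\eta\}$; marked nodes are those with $\mathrm{Sq}(\eta)\neq\emptyset$; $Q$ is the subtree of marked nodes and their ancestors. A monochild node of $Q$ is a non-root node with exactly one child in $Q$; a path $P\in Q_{\mathrm{paths}}$ is a maximal set of connected monochild nodes between two non-monochild nodes. Each node of $P$ is labelled by the quadrant of its unique child; $P_q$ is the set of nodes of $P$ with label $q$; $\mathrm{Sq}(P_q)=\bigcup_{\eta\in P_q}\mathrm{Sq}(\eta)$. $d(\eta)$ is the depth and $d(s)=d(\eta(s))$. For $s\in\mathrm{Sq}(P_q)$, $\eta'(s)$ is the deepest node of $P_q$ whose square's center lies in $s$ and $I_{P_q}(s)=[d(s),d(\eta'(s))]$. A subset $J\subseteq\mathrm{Sq}(P_q)$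 is interval-disjoint (interval independent) if the intervals $I_{P_q}(s)$, $s\in J$, are pairwise disjoint. $\mathrm{Half}(J)$ is obtained by ordering $J$ by depth and removing every other element, starting by removing the deepest. $\mathrm{OPT}(X)$ is the maximum size of a pairwise disjoint subset of the squares $X$.
   Formalization: The squares in S and the root square of the quadtree $Q^\infty$ have rational coordinates and side lengths, and the constant c is rational. -}

module Defs where

open import Data.Nat as ℕ using (ℕ)
open import Data.Integer using (+_)
open import Data.Rational as ℚ using (ℚ; ½; 0ℚ; 1ℚ)
open import Data.List using (List; []; _∷_; _++_; length; reverse)
open import Data.List.Membership.Propositional using (_∈_)
open import Data.List.Relation.Unary.Unique.Propositional using (Unique)
open import Data.List.Relation.Unary.Linked using (Linked)
open import Data.Product using (Σ; ∃; ∃-syntax; _×_; _,_)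
open import Data.Sum using (_⊎_)
open import Relation.Nullary using (¬_)
open import Relation.Binary.PropositionalEquality using (_≡_; _≢_)

-- An axis-aligned (closed) square [x , x + ℓ] × [y , y + ℓ].
record Square : Set where
  constructor sq
  field
    x : ℚ
    y : ℚ
    side : ℚ
open Square public

ℕtoℚ : ℕ → ℚ
ℕtoℚ n = (+ n) ℚ./ 1

Point : Set
Point = ℚ × ℚ

center : Square → Point
center s = (x s ℚ.+ ½ ℚ.* side s , y s ℚ.+ ½ ℚ.* side s)

PointIn : Point → Square → Set
PointIn (px , py) s =
  (x s ℚ.≤ px × px ℚ.≤ x s ℚ.+ side s) × (y s ℚ.≤ py × py ℚ.≤ y s ℚ.+ side s)

Contains : Square → Square → Set
Contains A B =
  (x A ℚ.≤ x B × x B ℚ.+ side B ℚ.≤ x A ℚ.+ side A) ×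
  (y A ℚ.≤ y B × y B ℚ.+ side B ℚ.≤ y A ℚ.+ side A)

Intersect : Square → Square → Set
Intersect A B =
  (x A ℚ.≤ x B ℚ.+ side B × x B ℚ.≤ x A ℚ.+ side A) ×
  (y A ℚ.≤ y B ℚ.+ side B × y B ℚ.≤ y A ℚ.+ side A)

Disjoint : Square → Square → Set
Disjoint A B = ¬ Intersect A B

-- quadrants (I = top-right, II = top-left, III = bottom-left, IV = bottom-right)
data Quad : Set where
  I II III IV : Quad

quadrant : Quad → Square → Square
quadrant I   (sq a b l) = sq (a ℚ.+ ½ ℚ.* l) (b ℚ.+ ½ ℚ.* l) (½ ℚ.* l)
quadrant II  (sq a b l) = sq a (b ℚ.+ ½ ℚ.* l) (½ ℚ.* l)
quadrant III (sq a b l) = sq a b (½ ℚ.* l)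
quadrant IV  (sq a b l) = sq (a ℚ.+ ½ ℚ.* l) b (½ ℚ.* l)

-- A node is the list of quadrant choices from the root, the LAST step first:
-- the child of ν in quadrant q is  q ∷ ν ; the root is [].
Node : Set
Node = List Quad

depth : Node → ℕ
depth = length

nodeSq : Square → Node → Square
nodeSq R []      = R
nodeSq R (q ∷ ν) = quadrant q (nodeSq R ν)

AncOrEq : Node → Node → Set
AncOrEq ν μ = ∃[ δ ] μ ≡ δ ++ ν

module _ (R : Square) (S : List Square) where

  IsEta : Square → Node → Set
  IsEta s η = Contains (nodeSq R η) s ×
              (∀ ν → Contains (nodeSq R ν) s → depth ν ℕ.≤ depth η)

  InSq : Node → Square → Set
  InSq η s = s ∈ S × IsEta s η × PointIn (center (nodeSq R η)) s

  Marked : Node → Set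
  Marked η = ∃[ s ] InSq η s

  InQ : Node → Set
  InQ ν = ∃[ η ] Marked η × AncOrEq ν η

  Monochild : Node → Set
  Monochild ν = ν ≢ [] × InQ ν ×
                (∃[ q ] InQ (q ∷ ν) × (∀ q' → InQ (q' ∷ ν) → q' ≡ q))

  Between : Node → Node → Node → Set
  Between t b ν = AncOrEq t ν × AncOrEq ν b

  -- the path P ∈ Q_paths with topmost node t and bottommost node b:
  -- a maximal chain of connected monochild nodes
  IsPath : Node → Node → Set
  IsPath t b = AncOrEq t b ×
               (∀ ν → Between t b ν → Monochild ν) ×
               (∀ q p → t ≡ q ∷ p → ¬ Monochild p) ×
               (∀ q → InQ (q ∷ b) → ¬ Monochild (q ∷ b))

  module _ (t b : Node) (q : Quad) where

    InPq : Node → Set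
    InPq ν = Between t b ν × InQ (q ∷ ν)

    InSqPq : Square → Set
    InSqPq s = ∃[ η ] InPq η × InSq η s

    IsEta' : Square → Node → Set
    IsEta' s ν = InPq ν × PointIn (center (nodeSq R ν)) s ×
                 (∀ ν' → InPq ν' → PointIn (center (nodeSq R ν')) s →
                   depth ν' ℕ.≤ depth ν)

    SubsetSqPq : List Square → Set
    SubsetSqPq J = Unique J × (∀ s → s ∈ J → InSqPq s)

    -- the intervals I(s) = [d(s), d(η'(s))], s ∈ J, are pairwise disjoint
    IntervalDisjoint : List Square → Set
    IntervalDisjoint J =
      ∀ s s' → s ∈ J → s' ∈ J → s ≢ s' →
      ∀ η η' ν ν' → IsEta s η → IsEta s' η' → IsEta' s ν → IsEta' s' ν' →
      (depth ν ℕ.< depth η') ⊎ (depth ν' ℕ.< depth η)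

    MaxIntervalDisjoint : List Square → Set
    MaxIntervalDisjoint J =
      SubsetSqPq J × IntervalDisjoint J ×
      (∀ J' → SubsetSqPq J' → IntervalDisjoint J' → length J' ℕ.≤ length J)

    IsOPT : ℕ → Set
    IsOPT k =
      (∃[ L ] SubsetSqPq L × PairwiseDisj L × length L ≡ k) ×
      (∀ L → SubsetSqPq L → PairwiseDisj L → length L ℕ.≤ k)
      where
      PairwiseDisj : List Square → Set
      PairwiseDisj L = ∀ s s' → s ∈ L → s' ∈ L → s ≢ s' → Disjoint s s'

  SortedByDepth : List Square → Set
  SortedByDepth J = Linked (λ s s' → ∀ η η' → IsEta s η → IsEta s' η' →
                                        depth η ℕ.≤ depth η') J

-- Half: remove every other element, starting by removing the deepest.
-- Applied to a list ordered by increasing depth.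

dropAlt : {A : Set} → List A → List A
dropAlt []           = []
dropAlt (_ ∷ [])     = []
dropAlt (_ ∷ y ∷ zs) = y ∷ dropAlt zs

Half : {A : Set} → List A → List A
Half J = reverse (dropAlt (reverse J))

{-# OPTIONS --safe #-}
-- Pairwise disjoint squares of Sq(P_q) are already interval-disjoint, so
-- OPT(Sq(P_q)) ≤ |J_opt| ≤ c|J| ≤ c(2|Half(J)| + 1).  Every node of P_q has its child in
-- quadrant q, so the centers of the nodes of P_q move monotonically into quadrant q
-- as the depth grows.  Hence if s ∈ Sq(α), s' ∈ Sq(β) with d(α) ≤ d(β) ≤ d(η'(s)),
-- the square s, which contains the centers of α and of η'(s), also contains the
-- center of β; as s' is centered, s and s' meet.
module Submission where

open import Defs
open import Data.Nat using (ℕ)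
open import Data.Rational using (ℚ; _≤_; _<_; _+_; _*_; 0ℚ; 1ℚ)
open import Data.List using (List; length)
open import Data.List.Membership.Propositional using (_∈_)

open import Data.Empty using (⊥-elim)
open import Data.Integer as ℤ using (+_)
import Data.Integer.Properties as ℤ
import Data.Nat as ℕ
import Data.Nat.Properties as ℕ
open import Data.Nat.Coprimality using (1-coprimeTo) renaming (sym to coprime-sym)
open import Data.List using ([]; _∷_; _++_; reverse)
open import Data.List.Properties using (length-reverse; ++-assoc; ∷-injectiveʳ; length-++-≤ʳ)
open import Data.Product using (∃-syntax; _×_; _,_; proj₁; proj₂)
open import Data.Sum using (inj₁; inj₂)
open import Data.Rational using (mkℚ; toℚᵘ; ½; *≤*; nonNegative)
open import Data.Rational.Properties
open import Data.Rational.Unnormalised as ℚᵘ using (mkℚᵘ; *≡*)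
import Data.Rational.Unnormalised.Properties as ℚᵘ
open import Function using (_∘_)
open import Relation.Binary.PropositionalEquality

ℕtoℚ≡mkℚ : ∀ n → ℕtoℚ n ≡ mkℚ (+ n) 0 (coprime-sym (1-coprimeTo n))
ℕtoℚ≡mkℚ n = normalize-coprime _

toℚᵘ-ℕtoℚ : ∀ n → toℚᵘ (ℕtoℚ n) ℚᵘ.≃ mkℚᵘ (+ n) 0
toℚᵘ-ℕtoℚ n rewrite ℕtoℚ≡mkℚ n = ℚᵘ.≃-refl

ℕtoℚ-+ : ∀ m n → ℕtoℚ (m ℕ.+ n) ≡ ℕtoℚ m + ℕtoℚ n
ℕtoℚ-+ m n = toℚᵘ-injective (begin
  toℚᵘ (ℕtoℚ (m ℕ.+ n))             ≈⟨ toℚᵘ-ℕtoℚ (m ℕ.+ n) ⟩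
  mkℚᵘ (+ m ℤ.+ + n) 0              ≈⟨ *≡* (cong (ℤ._* + 1) (sym (cong₂ ℤ._+_ m*1≡m n*1≡n))) ⟩
  mkℚᵘ (+ m) 0 ℚᵘ.+ mkℚᵘ (+ n) 0    ≈⟨ ℚᵘ.+-cong (ℚᵘ.≃-sym (toℚᵘ-ℕtoℚ m)) (ℚᵘ.≃-sym (toℚᵘ-ℕtoℚ n)) ⟩
  toℚᵘ (ℕtoℚ m) ℚᵘ.+ toℚᵘ (ℕtoℚ n)  ≈⟨ ℚᵘ.≃-sym (toℚᵘ-homo-+ (ℕtoℚ m) (ℕtoℚ n)) ⟩
  toℚᵘ (ℕtoℚ m + ℕtoℚ n)            ∎)
  where
  open ℚᵘ.≃-Reasoning
  m*1≡m : + m ℤ.* + 1 ≡ + m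
  m*1≡m = ℤ.*-identityʳ (+ m)
  n*1≡n : + n ℤ.* + 1 ≡ + n
  n*1≡n = ℤ.*-identityʳ (+ n)

ℕtoℚ-* : ∀ m n → ℕtoℚ (m ℕ.* n) ≡ ℕtoℚ m * ℕtoℚ n
ℕtoℚ-* m n = toℚᵘ-injective (begin
  toℚᵘ (ℕtoℚ (m ℕ.* n))             ≈⟨ toℚᵘ-ℕtoℚ (m ℕ.* n) ⟩
  mkℚᵘ (+ (m ℕ.* n)) 0              ≈⟨ *≡* (cong (ℤ._* + 1) (ℤ.pos-* m n)) ⟩
  mkℚᵘ (+ m) 0 ℚᵘ.* mkℚᵘ (+ n) 0    ≈⟨ ℚᵘ.*-cong (ℚᵘ.≃-sym (toℚᵘ-ℕtoℚ m)) (ℚᵘ.≃-sym (toℚᵘ-ℕtoℚ n)) ⟩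
  toℚᵘ (ℕtoℚ m) ℚᵘ.* toℚᵘ (ℕtoℚ n)  ≈⟨ ℚᵘ.≃-sym (toℚᵘ-homo-* (ℕtoℚ m) (ℕtoℚ n)) ⟩
  toℚᵘ (ℕtoℚ m * ℕtoℚ n)            ∎)
  where open ℚᵘ.≃-Reasoning

ℕtoℚ-mono-≤ : ∀ {m n} → m ℕ.≤ n → ℕtoℚ m ≤ ℕtoℚ n
ℕtoℚ-mono-≤ {m} {n} m≤n rewrite ℕtoℚ≡mkℚ m | ℕtoℚ≡mkℚ n =
  *≤* (ℤ.*-monoʳ-≤-nonNeg (+ 1) (ℤ.+≤+ m≤n))

length-dropAlt : ∀ {A : Set} (xs : List A) → length xs ℕ.≤ 2 ℕ.* length (dropAlt xs) ℕ.+ 1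
length-dropAlt []           = ℕ.z≤n
length-dropAlt (_ ∷ [])     = ℕ.≤-refl
length-dropAlt (_ ∷ _ ∷ xs) =
  subst (ℕ._≤_ _) (cong (ℕ._+ 1) (sym (ℕ.*-suc 2 (length (dropAlt xs)))))
    (ℕ.s≤s (ℕ.s≤s (length-dropAlt xs)))

length-Half : ∀ {A : Set} (xs : List A) → length xs ℕ.≤ 2 ℕ.* length (Half xs) ℕ.+ 1
length-Half xs =
  subst₂ (λ m n → m ℕ.≤ 2 ℕ.* n ℕ.+ 1)
    (length-reverse xs) (sym (length-reverse (dropAlt (reverse xs))))
    (length-dropAlt (reverse xs))

½*-nonNeg : ∀ {l} → 0ℚ ≤ l → 0ℚ ≤ ½ * l
½*-nonNeg {l} 0≤l = subst (_≤ ½ * l) (*-zeroʳ ½) (*-monoˡ-≤-nonNeg ½ 0≤l)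

p≤p+q : ∀ p {q} → 0ℚ ≤ q → p ≤ p + q
p≤p+q p {q} 0≤q = subst (_≤ p + q) (+-identityʳ p) (+-monoʳ-≤ p 0≤q)

+½*+½* : ∀ a l → a + ½ * l + ½ * l ≡ a + l
+½*+½* a l = begin
  a + ½ * l + ½ * l    ≡⟨ +-assoc a (½ * l) (½ * l) ⟩
  a + (½ * l + ½ * l)  ≡⟨ cong (_+_ a) (sym (*-distribʳ-+ l ½ ½)) ⟩
  a + 1ℚ * l           ≡⟨ cong (_+_ a) (*-identityˡ l) ⟩
  a + l                ∎
  where open ≡-Reasoning

midpoint-∈ : ∀ a {l} → 0ℚ ≤ l → a ≤ a + ½ * l × a + ½ * l ≤ a + l
midpoint-∈ a {l} 0≤l =
  p≤p+q a (½*-nonNeg 0≤l) ,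
  subst (a + ½ * l ≤_) (+½*+½* a l) (p≤p+q (a + ½ * l) (½*-nonNeg 0≤l))

lower-half-⊆ : ∀ a {l} → 0ℚ ≤ l → a ≤ a × a + ½ * l ≤ a + l
lower-half-⊆ a 0≤l = ≤-refl , proj₂ (midpoint-∈ a 0≤l)

upper-half-⊆ : ∀ a {l} → 0ℚ ≤ l → a ≤ a + ½ * l × a + ½ * l + ½ * l ≤ a + l
upper-half-⊆ a {l} 0≤l = proj₁ (midpoint-∈ a 0≤l) , ≤-reflexive (+½*+½* a l)

Contains-refl : ∀ A → Contains A A
Contains-refl A = (≤-refl , ≤-refl) , (≤-refl , ≤-refl)

Contains-trans : ∀ {A B C} → Contains A B → Contains B C → Contains A C
Contains-trans ((a₁ , a₂) , (a₃ , a₄)) ((b₁ , b₂) , (b₃ , b₄)) =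
  (≤-trans a₁ b₁ , ≤-trans b₂ a₂) , (≤-trans a₃ b₃ , ≤-trans b₄ a₄)

PointIn-Contains : ∀ {p A B} → Contains A B → PointIn p B → PointIn p A
PointIn-Contains ((a₁ , a₂) , (a₃ , a₄)) ((p₁ , p₂) , (p₃ , p₄)) =
  (≤-trans a₁ p₁ , ≤-trans p₂ a₂) , (≤-trans a₃ p₃ , ≤-trans p₄ a₄)

PointIn⇒Intersect : ∀ {p A B} → PointIn p A → PointIn p B → Intersect A B
PointIn⇒Intersect ((a₁ , a₂) , (a₃ , a₄)) ((b₁ , b₂) , (b₃ , b₄)) =
  (≤-trans a₁ b₂ , ≤-trans b₁ a₂) , (≤-trans a₃ b₄ , ≤-trans b₃ a₄)

center-∈ : ∀ s → 0ℚ ≤ side s → PointIn (center s) s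
center-∈ s 0≤l = midpoint-∈ (x s) 0≤l , midpoint-∈ (y s) 0≤l

quadrant-side-nonNeg : ∀ q s → 0ℚ ≤ side s → 0ℚ ≤ side (quadrant q s)
quadrant-side-nonNeg I   s = ½*-nonNeg
quadrant-side-nonNeg II  s = ½*-nonNeg
quadrant-side-nonNeg III s = ½*-nonNeg
quadrant-side-nonNeg IV  s = ½*-nonNeg

quadrant-⊆ : ∀ q s → 0ℚ ≤ side s → Contains s (quadrant q s)
quadrant-⊆ I   s 0≤l = upper-half-⊆ (x s) 0≤l , upper-half-⊆ (y s) 0≤l
quadrant-⊆ II  s 0≤l = lower-half-⊆ (x s) 0≤l , upper-half-⊆ (y s) 0≤l
quadrant-⊆ III s 0≤l = lower-half-⊆ (x s) 0≤l , lower-half-⊆ (y s) 0≤l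
quadrant-⊆ IV  s 0≤l = upper-half-⊆ (x s) 0≤l , lower-half-⊆ (y s) 0≤l

InOrthant : Quad → Point → Point → Set
InOrthant I   (cx , cy) (px , py) = cx ≤ px × cy ≤ py
InOrthant II  (cx , cy) (px , py) = px ≤ cx × cy ≤ py
InOrthant III (cx , cy) (px , py) = px ≤ cx × py ≤ cy
InOrthant IV  (cx , cy) (px , py) = cx ≤ px × py ≤ cy

InOrthant-refl : ∀ q p → InOrthant q p p
InOrthant-refl I   p = ≤-refl , ≤-refl
InOrthant-refl II  p = ≤-refl , ≤-refl
InOrthant-refl III p = ≤-refl , ≤-refl
InOrthant-refl IV  p = ≤-refl , ≤-refl

quadrant⇒InOrthant : ∀ q s {p} → PointIn p (quadrant q s) → InOrthant q (center s) p
quadrant⇒InOrthant I   s ((cx≤ , _) , (cy≤ , _)) = cx≤ , cy≤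
quadrant⇒InOrthant II  s ((_ , ≤cx) , (cy≤ , _)) = ≤cx , cy≤
quadrant⇒InOrthant III s ((_ , ≤cx) , (_ , ≤cy)) = ≤cx , ≤cy
quadrant⇒InOrthant IV  s ((cx≤ , _) , (_ , ≤cy)) = cx≤ , ≤cy

PointIn-InOrthant-between : ∀ q {p₁ p₂ p₃} s → InOrthant q p₁ p₂ → InOrthant q p₂ p₃ →
                            PointIn p₁ s → PointIn p₃ s → PointIn p₂ s
PointIn-InOrthant-between I s (x₁₂ , y₁₂) (x₂₃ , y₂₃)
                          ((x₁ , _) , (y₁ , _)) ((_ , x₃) , (_ , y₃)) =
  (≤-trans x₁ x₁₂ , ≤-trans x₂₃ x₃) , (≤-trans y₁ y₁₂ , ≤-trans y₂₃ y₃)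
PointIn-InOrthant-between II s (x₂₁ , y₁₂) (x₃₂ , y₂₃)
                          ((_ , x₁) , (y₁ , _)) ((x₃ , _) , (_ , y₃)) =
  (≤-trans x₃ x₃₂ , ≤-trans x₂₁ x₁) , (≤-trans y₁ y₁₂ , ≤-trans y₂₃ y₃)
PointIn-InOrthant-between III s (x₂₁ , y₂₁) (x₃₂ , y₃₂)
                          ((_ , x₁) , (_ , y₁)) ((x₃ , _) , (y₃ , _)) =
  (≤-trans x₃ x₃₂ , ≤-trans x₂₁ x₁) , (≤-trans y₃ y₃₂ , ≤-trans y₂₁ y₁)
PointIn-InOrthant-between IV s (x₁₂ , y₂₁) (x₂₃ , y₃₂)
                          ((x₁ , _) , (_ , y₁)) ((_ , x₃) , (y₃ , _)) =
  (≤-trans x₁ x₁₂ , ≤-trans x₂₃ x₃) , (≤-trans y₃ y₃₂ , ≤-trans y₂₁ y₁)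

AncOrEq-trans : ∀ {a b c} → AncOrEq a b → AncOrEq b c → AncOrEq a c
AncOrEq-trans {a} (δ , refl) (δ′ , refl) = δ′ ++ δ , sym (++-assoc δ′ δ a)

strict-descendant-of-child : ∀ x δ ν → ∃[ q ] AncOrEq (q ∷ ν) ((x ∷ δ) ++ ν)
strict-descendant-of-child x []      ν = x , [] , refl
strict-descendant-of-child x (y ∷ δ) ν with strict-descendant-of-child y δ ν
... | q , δ′ , eq = q , x ∷ δ′ , cong (x ∷_) eq

suffixes-ordered-by-length : ∀ δ δ′ {a a′} → δ ++ a ≡ δ′ ++ a′ →
                             length a ℕ.≤ length a′ → AncOrEq a a′
suffixes-ordered-by-length δ       []       eq       _   = δ , sym eq
suffixes-ordered-by-length []      (y ∷ δ′) {a′ = a′} refl len≤ =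
  ⊥-elim (ℕ.<⇒≱ (ℕ.s≤s (length-++-≤ʳ a′ {δ′})) len≤)
suffixes-ordered-by-length (x ∷ δ) (y ∷ δ′) eq       len≤ =
  suffixes-ordered-by-length δ δ′ (∷-injectiveʳ eq) len≤

ancestors-ordered-by-depth : ∀ {a a′ m} → AncOrEq a m → AncOrEq a′ m →
                             depth a ℕ.≤ depth a′ → AncOrEq a a′
ancestors-ordered-by-depth (δ , eq) (δ′ , eq′) =
  suffixes-ordered-by-length δ δ′ (trans (sym eq) eq′)

module _ {R : Square} (0≤R : 0ℚ ≤ side R) where

  nodeSq-side-nonNeg : ∀ ν → 0ℚ ≤ side (nodeSq R ν)
  nodeSq-side-nonNeg []      = 0≤R
  nodeSq-side-nonNeg (q ∷ ν) = quadrant-side-nonNeg q _ (nodeSq-side-nonNeg ν)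

  nodeSq-++-⊆ : ∀ δ ν → Contains (nodeSq R ν) (nodeSq R (δ ++ ν))
  nodeSq-++-⊆ []      ν = Contains-refl _
  nodeSq-++-⊆ (q ∷ δ) ν =
    Contains-trans (nodeSq-++-⊆ δ ν) (quadrant-⊆ q _ (nodeSq-side-nonNeg (δ ++ ν)))

  center-∈-ancestor : ∀ {ν μ} → AncOrEq ν μ → PointIn (center (nodeSq R μ)) (nodeSq R ν)
  center-∈-ancestor {ν} (δ , refl) =
    PointIn-Contains (nodeSq-++-⊆ δ ν) (center-∈ _ (nodeSq-side-nonNeg (δ ++ ν)))

module _ {R : Square} {S : List Square} where

  InQ-ancestor : ∀ {ν μ} → AncOrEq ν μ → InQ R S μ → InQ R S ν
  InQ-ancestor ν≼μ (η , marked , μ≼η) = η , marked , AncOrEq-trans ν≼μ μ≼η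

  descendant-center-InOrthant : 0ℚ ≤ side R → ∀ {q a m} →
    Monochild R S a → InQ R S (q ∷ a) → InQ R S m → AncOrEq a m →
    InOrthant q (center (nodeSq R a)) (center (nodeSq R m))
  descendant-center-InOrthant _ {q} _ _ _ ([] , refl) = InOrthant-refl q _
  descendant-center-InOrthant 0≤R {q} {a} (_ , _ , _ , _ , unique) qa∈Q m∈Q (x ∷ δ , refl)
    with strict-descendant-of-child x δ a
  ... | q₀ , q₀a≼m =
    subst (λ q′ → InOrthant q′ _ _) q₀≡q
      (quadrant⇒InOrthant q₀ (nodeSq R a) (center-∈-ancestor 0≤R q₀a≼m))
    where
    q₀≡q : q₀ ≡ q
    q₀≡q = trans (unique q₀ (InQ-ancestor q₀a≼m m∈Q)) (sym (unique q qa∈Q))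

IsEta-depth-unique : ∀ R S {s η η′} → IsEta R S s η → IsEta R S s η′ → depth η ≡ depth η′
IsEta-depth-unique _ _ {η = η} {η′} (η⊇s , η-deepest) (η′⊇s , η′-deepest) =
  ℕ.≤-antisym (η′-deepest η η⊇s) (η-deepest η′ η′⊇s)

PairwiseDisjoint : List Square → Set
PairwiseDisjoint L = ∀ s s′ → s ∈ L → s′ ∈ L → s ≢ s′ → Disjoint s s′

module _ {R : Square} {S : List Square} {t b : Node} {q : Quad}
         (0≤R : 0ℚ ≤ side R) (path : IsPath R S t b) where

  InPq-comparable : ∀ {a a′} → InPq R S t b q a → InPq R S t b q a′ →
                    depth a ℕ.≤ depth a′ → AncOrEq a a′
  InPq-comparable ((_ , a≼b) , _) ((_ , a′≼b) , _) = ancestors-ordered-by-depth a≼b a′≼b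

  InPq-center-InOrthant : ∀ {a a′} → InPq R S t b q a → InPq R S t b q a′ →
                          depth a ℕ.≤ depth a′ →
                          InOrthant q (center (nodeSq R a)) (center (nodeSq R a′))
  InPq-center-InOrthant a∈P@(a-between , qa∈Q) a′∈P@(_ , qa′∈Q) a≤a′ =
    descendant-center-InOrthant 0≤R (proj₁ (proj₂ path) _ a-between) qa∈Q
      (InQ-ancestor (q ∷ [] , refl) qa′∈Q) (InPq-comparable a∈P a′∈P a≤a′)

  center-∈-between : ∀ {a a′ ν s} →
                     InPq R S t b q a → InPq R S t b q a′ → InPq R S t b q ν →
                     depth a ℕ.≤ depth a′ → depth a′ ℕ.≤ depth ν →
                     PointIn (center (nodeSq R a)) s → PointIn (center (nodeSq R ν)) s →
                     PointIn (center (nodeSq R a′)) s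
  center-∈-between a∈P a′∈P ν∈P a≤a′ a′≤ν =
    PointIn-InOrthant-between q _ (InPq-center-InOrthant a∈P a′∈P a≤a′)
                                  (InPq-center-InOrthant a′∈P ν∈P a′≤ν)

  disjoint⇒interval-before : ∀ {s s′ a a′ η′ ν} → Disjoint s s′ →
    InPq R S t b q a → InSq R S a s → InPq R S t b q a′ → InSq R S a′ s′ →
    depth a ℕ.≤ depth a′ → IsEta R S s′ η′ → IsEta' R S t b q s ν → depth ν ℕ.< depth η′
  disjoint⇒interval-before {a′ = a′} {η′} disj a∈P (_ , _ , ca∈s) a′∈P (_ , s′↦a′ , ca′∈s′)
                           a≤a′ s′↦η′ (ν∈P , cν∈s , _) =
    ℕ.≰⇒> λ η′≤ν → disj (PointIn⇒Intersect
      (center-∈-between a∈P a′∈P ν∈P a≤a′ (subst (ℕ._≤ _) η′≡a′ η′≤ν) ca∈s cν∈s)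
      ca′∈s′)
    where
    η′≡a′ : depth η′ ≡ depth a′
    η′≡a′ = IsEta-depth-unique R S {η = η′} {a′} s′↦η′ s′↦a′

  PairwiseDisjoint⇒IntervalDisjoint : ∀ {L} → SubsetSqPq R S t b q L → PairwiseDisjoint L →
                                      IntervalDisjoint R S t b q L
  PairwiseDisjoint⇒IntervalDisjoint (_ , ⊆Sq) disj s s′ s∈ s′∈ s≢s′ η η′ ν ν′ ηs ηs′ η′s η′s′
    with ⊆Sq s s∈ | ⊆Sq s′ s′∈
  ... | a , a∈P , s∈a | a′ , a′∈P , s′∈a′ with ℕ.≤-total (depth a) (depth a′)
  ...   | inj₁ a≤a′ = inj₁ (disjoint⇒interval-before {a = a} {a′} {η′} {ν}
                              (disj s s′ s∈ s′∈ s≢s′) a∈P s∈a a′∈P s′∈a′ a≤a′ ηs′ η′s)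
  ...   | inj₂ a′≤a = inj₂ (disjoint⇒interval-before {a = a′} {a} {η} {ν′}
                              (disj s′ s s′∈ s∈ (s≢s′ ∘ sym)) a′∈P s′∈a′ a∈P s∈a a′≤a ηs η′s′)

lemma13 : (R : Square) → 0ℚ < side R →
    (S : List Square) →
    (∀ s → s ∈ S → 0ℚ < side s) →
    (∀ s → s ∈ S → Contains R s) →
    (t b : Node) → IsPath R S t b →
    (q : Quad) →
    (Jopt : List Square) → MaxIntervalDisjoint R S t b q Jopt →
    (J : List Square) → SubsetSqPq R S t b q J → IntervalDisjoint R S t b q J →
    SortedByDepth R S J →
    (c : ℚ) → 1ℚ ≤ c → ℕtoℚ (length Jopt) ≤ c * ℕtoℚ (length J) →
    (k : ℕ) → IsOPT R S t b q k →
    ℕtoℚ k ≤ (ℕtoℚ 2 * c) * (ℕtoℚ (length (Half J)) + 1ℚ)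
lemma13 _ 0<R _ _ _ _ _ path _ Jopt (_ , _ , Jopt-max) J _ _ _ c 1≤c Jopt≤cJ k
        ((L , L⊆Sq , L-disjoint , |L|≡k) , _) = begin
  ℕtoℚ k                        ≤⟨ ℕtoℚ-mono-≤ k≤|Jopt| ⟩
  ℕtoℚ (length Jopt)            ≤⟨ Jopt≤cJ ⟩
  c * ℕtoℚ (length J)           ≤⟨ *-monoˡ-≤-nonNeg c {{nonNegative 0≤c}} (ℕtoℚ-mono-≤ |J|≤2[h+1]) ⟩
  c * ℕtoℚ (2 ℕ.* (h ℕ.+ 1))    ≡⟨ cong (c *_) (ℕtoℚ-* 2 (h ℕ.+ 1)) ⟩
  c * (ℕtoℚ 2 * ℕtoℚ (h ℕ.+ 1)) ≡⟨ cong (λ z → c * (ℕtoℚ 2 * z)) (ℕtoℚ-+ h 1) ⟩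
  c * (ℕtoℚ 2 * (ℕtoℚ h + 1ℚ))  ≡⟨ sym (*-assoc c (ℕtoℚ 2) _) ⟩
  c * ℕtoℚ 2 * (ℕtoℚ h + 1ℚ)    ≡⟨ cong (_* (ℕtoℚ h + 1ℚ)) (*-comm c (ℕtoℚ 2)) ⟩
  ℕtoℚ 2 * c * (ℕtoℚ h + 1ℚ)    ∎
  where
  open ≤-Reasoning
  h : ℕ
  h = length (Half J)
  0≤c : 0ℚ ≤ c
  0≤c = ≤-trans (nonNegative⁻¹ 1ℚ) 1≤c
  k≤|Jopt| : k ℕ.≤ length Jopt
  k≤|Jopt| = subst (ℕ._≤ length Jopt) |L|≡k
    (Jopt-max L L⊆Sq (PairwiseDisjoint⇒IntervalDisjoint (<⇒≤ 0<R) path L⊆Sq L-disjoint))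
  |J|≤2[h+1] : length J ℕ.≤ 2 ℕ.* (h ℕ.+ 1)
  |J|≤2[h+1] = ℕ.≤-trans (length-Half J)
    (subst (2 ℕ.* h ℕ.+ 1 ℕ.≤_) (sym (ℕ.*-distribˡ-+ 2 h 1))
      (ℕ.+-monoʳ-≤ (2 ℕ.* h) (ℕ.n≤1+n 1)))
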